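{- Let $k\geq 1$ and let $p_1,\ldots,p_k$ be distinct Wieferich primes. Put $L=\operatorname{lcm}(p_1-1,\ldots,p_k-1)$. Then $$ g(1,2^L-1,2^L) > \log\left(\frac{p_1\cdots p_k}{2^{k+1}L}\right).$$
   Context: A Wieferich prime is a prime $p$ such that $p^2$ divides $2^{p-1}-1$. The function $\mu:\mathbb{Z}_{\geq1}\to\mathbb{R}_{\geq 0}$ is defined by $\mu(q_1^{n_1}\cdots q_r^{n_r})=\log(q_1\cdots q_r)+\log(n_1\cdots n_r)$ for distinct primes $q_1,\ldots,q_r$ and positive integers $n_1,\ldots,n_r$ (natural logarithm; $\mu(1)=0$). For positive integers $a,b,c$, the gain is $g(a,b,c)=\log c-\mu(abc)$. -}

module Defs where

open import Data.Nat using (ℕ; zero; suc; _*_; _∸_; _^_; _/_)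
open import Data.Nat.Divisibility using (_∣_; _∣?_)
open import Data.Nat.Primality using (Prime; prime?)
open import Data.Nat.LCM using (lcm)
open import Data.List using (List; filter; map; upTo; foldr; allFin)
open import Data.Nat.ListAction using (product)
open import Data.Fin using (Fin)
open import Data.Product using (_×_)
open import Relation.Nullary using (yes; no)
open import Relation.Nullary.Decidable using (_×-dec_)

Wieferich : ℕ → Set
Wieferich p = Prime p × (p ^ 2 ∣ 2 ^ (p ∸ 1) ∸ 1)

primeDivisors : ℕ → List ℕ
primeDivisors n = filter (λ q → prime? q ×-dec q ∣? n) (upTo (suc n))

-- q-adic valuation of m, computed with fuel (fuel m suffices for q ≥ 2, m ≥ 1).
valFuel : ℕ → ℕ → ℕ → ℕ
valFuel zero    q       m = 0
valFuel (suc f) zero    m = 0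
valFuel (suc f) (suc q) m with suc q ∣? m
... | yes _ = suc (valFuel f (suc q) (m / suc q))
... | no  _ = 0

val : ℕ → ℕ → ℕ
val q m = valFuel m q m

rad : ℕ → ℕ
rad n = product (primeDivisors n)

expProd : ℕ → ℕ
expProd n = product (map (λ q → val q n) (primeDivisors n))

-- expμ n = exp(μ(n)) = (q₁⋯q_r)·(n₁⋯n_r)
expμ : ℕ → ℕ
expμ n = rad n * expProd n

lcmFin : (k : ℕ) → (Fin k → ℕ) → ℕ
lcmFin k f = foldr lcm 1 (map f (allFin k))

prodFin : (k : ℕ) → (Fin k → ℕ) → ℕ
prodFin k f = product (map f (allFin k))

{-# OPTIONS --safe #-}
module Submission where

-- Put T = 2^L, N = T − 1 (odd) and M = N·T, so that expμ M = ∏_{q ∣ M} q·v_q(M).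
-- The prime 2 contributes 2·v_2(M) = 2L.  An odd prime q contributes q·v_q ≤ q^{v_q},
-- and if q² ∣ N, i.e. v_q ≥ 2, even q·(q·v_q) ≤ 2·q^{v_q}.  Every p_i is of the latter
-- kind, since p_i² ∣ 2^{p_i − 1} − 1 ∣ 2^L − 1.  Multiplying these bounds over the
-- prime divisors of M gives P·expμ M ≤ 2^k·2L·∏_{q odd} q^{v_q} = 2^{k+1}·L·N < 2^{k+1}·L·T.

open import Defs
open import Data.Fin using (Fin)
open import Data.List using (List; []; _∷_; map; length; foldr; upTo; allFin)
open import Data.List.Membership.Propositional using (_∈_)
open import Data.List.Membership.Propositional.Properties
  using (∈-map⁺; ∈-filter⁺; ∈-filter⁻; ∈-upTo⁺; ∈-allFin)
open import Data.List.Properties using (map-cong; map-cong-local; length-map; length-tabulate)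
open import Data.List.Relation.Binary.Subset.Propositional using (_⊆_)
open import Data.List.Relation.Unary.All as All using (All; []; _∷_)
import Data.List.Relation.Unary.All.Properties as All
open import Data.List.Relation.Unary.AllPairs using (_∷_)
open import Data.List.Relation.Unary.Any using (here; there)
open import Data.List.Relation.Unary.Unique.Propositional using (Unique)
open import Data.List.Relation.Unary.Unique.Propositional.Properties as Unique
  using (upTo⁺; allFin⁺)
open import Data.Nat
open import Data.Nat.Divisibility
open import Data.Nat.DivMod using (m≥n⇒m/n>0)
open import Data.Nat.GCD using (gcd)
open import Data.Nat.LCM using (lcm; m∣lcm[m,n]; n∣lcm[m,n]; gcd*lcm)
open import Data.Nat.ListAction using (product)
open import Data.Nat.Primality
open import Data.Nat.Properties
open import Algebra.Properties.CommutativeSemigroup *-commutativeSemigroup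
  using (interchange; x∙yz≈y∙xz; x∙yz≈z∙xy)
open import Data.Nat.Solver using (module +-*-Solver)
open import Data.Product using (_×_; _,_; proj₁; proj₂)
open import Data.Sum using (inj₁; inj₂)
open import Function using (_∘_)
open import Function.Definitions using (Injective)
open import Relation.Binary.PropositionalEquality
open import Relation.Nullary using (¬_; yes; no; contradiction)
open import Relation.Nullary.Decidable using (_×-dec_)

open +-*-Solver using (solve; con; _:*_; _:=_)

_[_≔_] : (ℕ → ℕ) → ℕ → ℕ → ℕ → ℕ
(f [ p ≔ x ]) q with q ≟ p
... | yes _ = x
... | no  _ = f q

update-≡ : ∀ f p x → (f [ p ≔ x ]) p ≡ x
update-≡ f p x with p ≟ p
... | yes _   = refl
... | no  p≢p = contradiction refl p≢p

update-≢ : ∀ f {p q} x → q ≢ p → (f [ p ≔ x ]) q ≡ f q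
update-≢ f {p} {q} x q≢p with q ≟ p
... | yes q≡p = contradiction q≡p q≢p
... | no  _   = refl

update-self : ∀ f p → f [ p ≔ f p ] ≗ f
update-self f p q with q ≟ p
... | yes refl = refl
... | no  _    = refl

product-map-mono-≤ : ∀ {f g : ℕ → ℕ} R → (∀ {q} → q ∈ R → f q ≤ g q) →
                     product (map f R) ≤ product (map g R)
product-map-mono-≤ []      f≤g = ≤-refl
product-map-mono-≤ (q ∷ R) f≤g = *-mono-≤ (f≤g (here refl)) (product-map-mono-≤ R (f≤g ∘ there))

product*product-map : ∀ R (f : ℕ → ℕ) → product R * product (map f R) ≡ product (map (λ q → q * f q) R)
product*product-map []      f = refl
product*product-map (q ∷ R) f =
  trans (interchange q (product R) (f q) _) (cong (q * f q *_) (product*product-map R f))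

product-update : ∀ {R p} → Unique R → p ∈ R → ∀ f x →
                 product (map (f [ p ≔ x ]) R) ≡ x * product (map (f [ p ≔ 1 ]) R)
product-update {p ∷ R} (p∉R ∷ _) (here refl) f x = begin
  (f [ p ≔ x ]) p * product (map (f [ p ≔ x ]) R)
    ≡⟨ cong₂ _*_ (update-≡ f p x) (cong product (map-cong-local (All.map off-p p∉R))) ⟩
  x * product (map (f [ p ≔ 1 ]) R)
    ≡⟨ cong (x *_) (*-identityˡ _) ⟨
  x * (1 * product (map (f [ p ≔ 1 ]) R))
    ≡⟨ cong (λ y → x * (y * product (map (f [ p ≔ 1 ]) R))) (update-≡ f p 1) ⟨
  x * ((f [ p ≔ 1 ]) p * product (map (f [ p ≔ 1 ]) R)) ∎
  where
  open ≡-Reasoning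
  off-p : ∀ {q} → p ≢ q → (f [ p ≔ x ]) q ≡ (f [ p ≔ 1 ]) q
  off-p p≢q = trans (update-≢ f x (≢-sym p≢q)) (sym (update-≢ f 1 (≢-sym p≢q)))
product-update {y ∷ R} {p} (y∉R ∷ uR) (there p∈R) f x = begin
  (f [ p ≔ x ]) y * product (map (f [ p ≔ x ]) R)
    ≡⟨ cong₂ _*_ (update-≢ f x y≢p) (product-update uR p∈R f x) ⟩
  f y * (x * product (map (f [ p ≔ 1 ]) R))
    ≡⟨ x∙yz≈y∙xz (f y) x _ ⟩
  x * (f y * product (map (f [ p ≔ 1 ]) R))
    ≡⟨ cong (λ z → x * (z * product (map (f [ p ≔ 1 ]) R))) (update-≢ f 1 y≢p) ⟨
  x * ((f [ p ≔ 1 ]) y * product (map (f [ p ≔ 1 ]) R)) ∎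
  where
  open ≡-Reasoning
  y≢p = All.lookup y∉R p∈R

product-extract : ∀ {R p} → Unique R → p ∈ R → ∀ f →
                  product (map f R) ≡ f p * product (map (f [ p ≔ 1 ]) R)
product-extract {R} {p} uR p∈R f =
  trans (cong product (map-cong (sym ∘ update-self f p) R)) (product-update uR p∈R f (f p))

product-scale : ∀ {R p} → Unique R → p ∈ R → ∀ f c →
                product (map (f [ p ≔ c * f p ]) R) ≡ c * product (map f R)
product-scale {R} {p} uR p∈R f c = begin
  product (map (f [ p ≔ c * f p ]) R)      ≡⟨ product-update uR p∈R f (c * f p) ⟩
  c * f p * product (map (f [ p ≔ 1 ]) R)  ≡⟨ *-assoc c (f p) _ ⟩
  c * (f p * product (map (f [ p ≔ 1 ]) R)) ≡⟨ cong (c *_) (product-extract uR p∈R f) ⟨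
  c * product (map f R)                    ∎
  where open ≡-Reasoning

weighted-product-≤ : ∀ {R S} c (a b : ℕ → ℕ) → Unique R → Unique S → S ⊆ R →
                     (∀ {q} → q ∈ R → a q ≤ b q) → (∀ {q} → q ∈ S → q * a q ≤ c * b q) →
                     product S * product (map a R) ≤ c ^ length S * product (map b R)
weighted-product-≤ {R} {[]} c a b uR uS S⊆R a≤b _ = *-monoʳ-≤ 1 (product-map-mono-≤ R a≤b)
weighted-product-≤ {R} {p ∷ S} c a b uR (p∉S ∷ uS) S⊆R a≤b pa≤cb = begin
  p * product S * product (map a R)                    ≡⟨ *-assoc p _ _ ⟩
  p * (product S * product (map a R))                  ≡⟨ x∙yz≈y∙xz p (product S) _ ⟩
  product S * (p * product (map a R))                  ≡⟨ cong (product S *_) (product-scale uR p∈R a p) ⟨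
  product S * product (map (a [ p ≔ p * a p ]) R)
    ≤⟨ weighted-product-≤ c (a [ p ≔ p * a p ]) (b [ p ≔ c * b p ])
                          uR uS (S⊆R ∘ there) a′≤b′ pa′≤cb′ ⟩
  c ^ length S * product (map (b [ p ≔ c * b p ]) R)   ≡⟨ cong (c ^ length S *_) (product-scale uR p∈R b c) ⟩
  c ^ length S * (c * product (map b R))               ≡⟨ x∙yz≈y∙xz (c ^ length S) c _ ⟩
  c * (c ^ length S * product (map b R))               ≡⟨ *-assoc c _ _ ⟨
  c * c ^ length S * product (map b R)                 ∎
  where
  open ≤-Reasoning
  p∈R = S⊆R (here refl)
  a′≤b′ : ∀ {q} → q ∈ R → (a [ p ≔ p * a p ]) q ≤ (b [ p ≔ c * b p ]) q
  a′≤b′ {q} q∈R with q ≟ p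
  ... | yes refl = pa≤cb (here refl)
  ... | no  _    = a≤b q∈R
  pa′≤cb′ : ∀ {q} → q ∈ S → q * (a [ p ≔ p * a p ]) q ≤ c * (b [ p ≔ c * b p ]) q
  pa′≤cb′ q∈S rewrite update-≢ a (p * a p) (≢-sym (All.lookup p∉S q∈S))
                    | update-≢ b (c * b p) (≢-sym (All.lookup p∉S q∈S)) = pa≤cb (there q∈S)

prime⇒>1 : ∀ {q} → Prime q → q > 1
prime⇒>1 {q} pq = nonTrivial⇒n>1 q {{prime⇒nonTrivial pq}}

n<m^n : ∀ {m} n → m > 1 → n < m ^ n
n<m^n zero    m>1 = s≤s z≤n
n<m^n {m} (suc n) m>1 = begin-strict
  suc n            <⟨ +-monoʳ-≤ 1 (n<m^n n m>1) ⟩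
  1 + m ^ n        ≤⟨ +-monoˡ-≤ (m ^ n) (m^n>0 m n) ⟩
  m ^ n + m ^ n    ≡⟨ cong (m ^ n +_) (+-identityʳ (m ^ n)) ⟨
  2 * m ^ n        ≤⟨ *-monoˡ-≤ (m ^ n) m>1 ⟩
  m * m ^ n        ∎
  where
  open ≤-Reasoning
  instance _ = >-nonZero (<-trans z<s m>1)

m*n≤m^n : ∀ {m} n → m > 1 → m * n ≤ m ^ n
m*n≤m^n {m} zero    _   rewrite *-zeroʳ m = z≤n
m*n≤m^n {m} (suc n) m>1 = *-monoʳ-≤ m (n<m^n n m>1)

m*[m*n]≤2*m^n : ∀ {m} n → m > 1 → n > 1 → m * (m * n) ≤ 2 * m ^ n
m*[m*n]≤2*m^n {m} (suc (suc n)) m>1 _ = begin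
  m * (m * (2 + n))     ≤⟨ *-monoʳ-≤ m (*-monoʳ-≤ m (n<m^n {2} (suc n) ≤-refl)) ⟩
  m * (m * (2 * 2 ^ n)) ≤⟨ *-monoʳ-≤ m (*-monoʳ-≤ m (*-monoʳ-≤ 2 (^-monoˡ-≤ n m>1))) ⟩
  m * (m * (2 * m ^ n))
    ≡⟨ solve 2 (λ m x → m :* (m :* (con 2 :* x)) := con 2 :* (m :* (m :* x))) refl m (m ^ n) ⟩
  2 * (m * (m * m ^ n)) ∎
  where open ≤-Reasoning
m*[m*n]≤2*m^n (suc zero) _ (s≤s ())

^-monoʳ-∣ : ∀ m {a b} → a ≤ b → m ^ a ∣ m ^ b
^-monoʳ-∣ m {b = b} z≤n       = 1∣ (m ^ b)
^-monoʳ-∣ m         (s≤s a≤b) = *-monoʳ-∣ m (^-monoʳ-∣ m a≤b)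

pow-valFuel∣ : ∀ f q m → q ^ valFuel f q m ∣ m
pow-valFuel∣ zero    q       m = 1∣ m
pow-valFuel∣ (suc f) zero    m = 1∣ m
pow-valFuel∣ (suc f) (suc q) m with suc q ∣? m
... | yes q∣m = m∣n/o⇒o*m∣n q∣m (pow-valFuel∣ f (suc q) (m / suc q))
... | no  _   = 1∣ m

pow-val∣ : ∀ q m → q ^ val q m ∣ m
pow-val∣ q m = pow-valFuel∣ m q m

pow∣⇒≤valFuel : ∀ f q m {a} → a ≤ f → .{{NonZero m}} → q ^ a ∣ m → a ≤ valFuel f q m
pow∣⇒≤valFuel f       q       m {zero}  _         _     = z≤n
pow∣⇒≤valFuel (suc f) zero    m {suc a} _         q^a∣m =
  contradiction (0∣⇒≡0 (m*n∣⇒m∣ 0 (0 ^ a) q^a∣m)) (≢-nonZero⁻¹ m)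
pow∣⇒≤valFuel (suc f) (suc q) m {suc a} (s≤s a≤f) q^a∣m with suc q ∣? m
... | yes q∣m = s≤s (pow∣⇒≤valFuel f (suc q) (m / suc q) a≤f {{>-nonZero (m≥n⇒m/n>0 (∣⇒≤ q∣m))}}
                                    (m*n∣o⇒n∣o/m (suc q) _ q^a∣m))
... | no  q∤m = contradiction (m*n∣⇒m∣ (suc q) _ q^a∣m) q∤m

-- Fuel m suffices because a < q ^ a ≤ m.
pow∣⇒≤val : ∀ {q m a} → q > 1 → .{{NonZero m}} → q ^ a ∣ m → a ≤ val q m
pow∣⇒≤val {q} {m} {a} q>1 q^a∣m =
  pow∣⇒≤valFuel m q m (<⇒≤ (<-≤-trans (n<m^n a q>1) (∣⇒≤ q^a∣m))) q^a∣m

val[n*q^k]≡k : ∀ {q n} k → q > 1 → .{{NonZero n}} → ¬ q ∣ n → val q (n * q ^ k) ≡ k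
val[n*q^k]≡k {q} {n} k q>1 q∤n = ≤-antisym (≮⇒≥ k≮v) (pow∣⇒≤val q>1 (n∣m*n n))
  where
  instance
    _ = >-nonZero (<-trans z<s q>1)
    _ = m^n≢0 q k
    _ = m*n≢0 n (q ^ k)
  k≮v : ¬ k < val q (n * q ^ k)
  k≮v k<v = q∤n (*-cancelʳ-∣ (q ^ k) (∣-trans (^-monoʳ-∣ q k<v) (pow-val∣ q (n * q ^ k))))

prime∣prime^⇒≡ : ∀ {q r} e → Prime q → Prime r → q ∣ r ^ e → q ≡ r
prime∣prime^⇒≡ zero    pq pr q∣1 = contradiction (subst Prime (∣1⇒≡1 q∣1) pq) ¬prime[1]
prime∣prime^⇒≡ {r = r} (suc e) pq pr q∣r*r^e with euclidsLemma r (r ^ e) pq q∣r*r^e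
... | inj₂ q∣r^e = prime∣prime^⇒≡ e pq pr q∣r^e
... | inj₁ q∣r   with prime⇒irreducible pr q∣r
...   | inj₁ refl = contradiction pq ¬prime[1]
...   | inj₂ q≡r  = q≡r

prime^∣*⇒prime^∣ : ∀ {q m} n a → Prime q → ¬ q ∣ m → q ^ a ∣ m * n → q ^ a ∣ n
prime^∣*⇒prime^∣         n zero    _  _   _        = 1∣ n
prime^∣*⇒prime^∣ {q} {m} n (suc a) pq q∤m q^a∣m*n with euclidsLemma m n pq (m*n∣⇒m∣ q (q ^ a) q^a∣m*n)
... | inj₁ q∣m             = contradiction q∣m q∤m
... | inj₂ (divides t refl) = subst (q * q ^ a ∣_) (*-comm q t) (*-monoʳ-∣ q q^a∣t)
  where
  q^a∣m*t : q ^ a ∣ m * t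
  q^a∣m*t = *-cancelˡ-∣ q {{prime⇒nonZero pq}} (subst (q * q ^ a ∣_) (x∙yz≈z∙xy m t q) q^a∣m*n)
  q^a∣t : q ^ a ∣ t
  q^a∣t = prime^∣*⇒prime^∣ t a pq q∤m q^a∣m*t

product-prime^∣ : ∀ {D} (e : ℕ → ℕ) n → Unique D → All Prime D → (∀ {q} → q ∈ D → q ^ e q ∣ n) →
                  product (map (λ q → q ^ e q) D) ∣ n
product-prime^∣ {[]}    e n _            _           _     = 1∣ n
product-prime^∣ {q ∷ D} e n (q∉D ∷ uD) (pq ∷ pD) D∣n with D∣n (here refl)
... | divides t refl =
  ∣-trans (*-monoʳ-∣ (q ^ e q) (product-prime^∣ e t uD pD D∣t)) (∣-reflexive (*-comm (q ^ e q) t))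
  where
  D∣t : ∀ {r} → r ∈ D → r ^ e r ∣ t
  D∣t {r} r∈D = prime^∣*⇒prime^∣ t (e r) (All.lookup pD r∈D)
    (λ r∣q^e → All.lookup q∉D r∈D (sym (prime∣prime^⇒≡ (e q) (All.lookup pD r∈D) pq r∣q^e)))
    (subst (r ^ e r ∣_) (*-comm t (q ^ e q)) (D∣n (there r∈D)))

module _ (n : ℕ) where

  private
    isPrimeDivisor? = λ q → prime? q ×-dec q ∣? n

  primeDivisors-unique : Unique (primeDivisors n)
  primeDivisors-unique = Unique.filter⁺ isPrimeDivisor? (upTo⁺ (suc n))

  ∈-primeDivisors⁻ : ∀ {q} → q ∈ primeDivisors n → Prime q × q ∣ n
  ∈-primeDivisors⁻ q∈ = proj₂ (∈-filter⁻ isPrimeDivisor? {xs = upTo (suc n)} q∈)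

  ∈-primeDivisors⁺ : ∀ {q} → .{{NonZero n}} → Prime q → q ∣ n → q ∈ primeDivisors n
  ∈-primeDivisors⁺ pq q∣n = ∈-filter⁺ isPrimeDivisor? (∈-upTo⁺ (s≤s (∣⇒≤ q∣n))) (pq , q∣n)

  expμ≡product : expμ n ≡ product (map (λ q → q * val q n) (primeDivisors n))
  expμ≡product = product*product-map (primeDivisors n) (λ q → val q n)

m∸1∣m^n∸1 : ∀ m n → m ∸ 1 ∣ m ^ n ∸ 1
m∸1∣m^n∸1 m       zero    = (m ∸ 1) ∣0
m∸1∣m^n∸1 zero    (suc n) = 0 ∣0
-- (1 + m) ^ (1 + n) ∸ 1 = ((1 + m) ^ n ∸ 1) + m * (1 + m) ^ n
m∸1∣m^n∸1 (suc m) (suc n) = subst (m ∣_) (sym (+-∸-comm (m * suc m ^ n) (m^n>0 (suc m) n)))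
  (∣m∣n⇒∣m+n (m∸1∣m^n∸1 (suc m) n) (m∣m*n (suc m ^ n)))

m^a∸1∣m^b∸1 : ∀ m {a b} → a ∣ b → m ^ a ∸ 1 ∣ m ^ b ∸ 1
m^a∸1∣m^b∸1 m {a} (divides c refl) =
  subst (λ x → m ^ a ∸ 1 ∣ x ∸ 1) (trans (^-*-assoc m a c) (cong (m ^_) (*-comm a c)))
        (m∸1∣m^n∸1 (m ^ a) c)

2∣2^n : ∀ n → .{{NonZero n}} → 2 ∣ 2 ^ n
2∣2^n (suc n) = m∣m*n (2 ^ n)

2∤2^n∸1 : ∀ n → .{{NonZero n}} → ¬ 2 ∣ 2 ^ n ∸ 1
2∤2^n∸1 n 2∣2^n∸1 = contradiction (∣1⇒≡1 (∣m+n∣m⇒∣n 2∣[2^n∸1]+1 2∣2^n∸1)) λ ()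
  where
  2∣[2^n∸1]+1 : 2 ∣ (2 ^ n ∸ 1) + 1
  2∣[2^n∸1]+1 = subst (2 ∣_) (sym (m∸n+n≡m (m^n>0 2 n))) (2∣2^n n)

∈⇒∣foldr-lcm : ∀ {x xs} → x ∈ xs → x ∣ foldr lcm 1 xs
∈⇒∣foldr-lcm {xs = y ∷ xs} (here refl) = m∣lcm[m,n] y _
∈⇒∣foldr-lcm {xs = y ∷ xs} (there x∈) = ∣-trans (∈⇒∣foldr-lcm x∈) (n∣lcm[m,n] y _)

lcm≢0 : ∀ m n → .{{NonZero m}} → .{{NonZero n}} → NonZero (lcm m n)
lcm≢0 m n = m*n≢0⇒n≢0 (gcd m n) {{subst NonZero (sym (gcd*lcm m n)) (m*n≢0 m n)}}

foldr-lcm≢0 : ∀ {xs} → All NonZero xs → NonZero (foldr lcm 1 xs)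
foldr-lcm≢0 []             = _
foldr-lcm≢0 {x ∷ _} (x≢0 ∷ xs≢0) = lcm≢0 x _ {{x≢0}} {{foldr-lcm≢0 xs≢0}}

module _ (N L : ℕ) .{{_ : NonZero L}} (2∤N : ¬ 2 ∣ N) where

  private
    instance
      N≢0 : NonZero N
      N≢0 = ≢-nonZero (λ { refl → 2∤N (2 ∣0) })
      2^L≢0 : NonZero (2 ^ L)
      2^L≢0 = m^n≢0 2 L
      M≢0 : NonZero (N * 2 ^ L)
      M≢0 = m*n≢0 N (2 ^ L)

    M = N * 2 ^ L
    D = primeDivisors M
    uD = primeDivisors-unique M

    v : ℕ → ℕ
    v q = val q M

    part : ℕ → ℕ
    part q = q ^ v q

    v₂≡L : v 2 ≡ L
    v₂≡L = val[n*q^k]≡k L ≤-refl 2∤N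

    2∈D : 2 ∈ D
    2∈D = ∈-primeDivisors⁺ M prime[2] (∣-trans (2∣2^n L) (n∣m*n N))

    ∏part≡2^L*∏odd : product (map part D) ≡ 2 ^ L * product (map (part [ 2 ≔ 1 ]) D)
    ∏part≡2^L*∏odd =
      trans (product-extract uD 2∈D part) (cong (λ e → 2 ^ e * product (map (part [ 2 ≔ 1 ]) D)) v₂≡L)

    ∏part∣M : product (map part D) ∣ M
    ∏part∣M = product-prime^∣ v M uD (All.tabulate (proj₁ ∘ ∈-primeDivisors⁻ M))
                                     (λ {q} _ → pow-val∣ q M)

    ∏odd∣N : product (map (part [ 2 ≔ 1 ]) D) ∣ N
    ∏odd∣N = *-cancelˡ-∣ (2 ^ L)
      (subst (_∣ 2 ^ L * N) ∏part≡2^L*∏odd (∣-trans ∏part∣M (∣-reflexive (*-comm N (2 ^ L)))))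

    b : ℕ → ℕ
    b = part [ 2 ≔ 2 * L ]

    ∏b≤2LN : product (map b D) ≤ 2 * L * N
    ∏b≤2LN = begin
      product (map b D)                         ≡⟨ product-update uD 2∈D part (2 * L) ⟩
      2 * L * product (map (part [ 2 ≔ 1 ]) D)  ≤⟨ *-monoʳ-≤ (2 * L) (∣⇒≤ ∏odd∣N) ⟩
      2 * L * N                                 ∎
      where open ≤-Reasoning

    a≤b : ∀ {q} → q ∈ D → q * v q ≤ b q
    a≤b {q} q∈D with q ≟ 2
    ... | yes refl = ≤-reflexive (cong (2 *_) v₂≡L)
    ... | no  _    = m*n≤m^n (v q) (prime⇒>1 (proj₁ (∈-primeDivisors⁻ M q∈D)))

    square-divisor∈D : ∀ {q} → Prime q → q ^ 2 ∣ N → q ∈ D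
    square-divisor∈D {q} pq q²∣N =
      ∈-primeDivisors⁺ M pq (∣-trans (m∣m*n (q ^ 1)) (∣-trans q²∣N (m∣m*n (2 ^ L))))

    square-divisor-bound : ∀ {q} → Prime q → q ^ 2 ∣ N → q * (q * v q) ≤ 2 * b q
    square-divisor-bound {q} pq q²∣N =
      subst (λ x → q * (q * v q) ≤ 2 * x) (sym (update-≢ part (2 * L) q≢2)) (m*[m*n]≤2*m^n (v q) q>1 v≥2)
      where
      q>1 = prime⇒>1 pq
      q≢2 : q ≢ 2
      q≢2 refl = 2∤N (∣-trans (m∣m*n (2 ^ 1)) q²∣N)
      v≥2 : v q ≥ 2
      v≥2 = pow∣⇒≤val q>1 (∣-trans q²∣N (m∣m*n (2 ^ L)))

  product*expμ[N*2^L]≤ : ∀ S → Unique S → All Prime S → All (λ q → q ^ 2 ∣ N) S →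
                         product S * expμ (N * 2 ^ L) ≤ 2 ^ (length S + 1) * L * N
  product*expμ[N*2^L]≤ S uS pS S²∣N = begin
    product S * expμ M                           ≡⟨ cong (product S *_) (expμ≡product M) ⟩
    product S * product (map (λ q → q * v q) D)  ≤⟨ weighted-product-≤ 2 _ b uD uS S⊆D a≤b S-bound ⟩
    2 ^ length S * product (map b D)             ≤⟨ *-monoʳ-≤ (2 ^ length S) ∏b≤2LN ⟩
    2 ^ length S * (2 * L * N)
      ≡⟨ solve 3 (λ x l n → x :* (con 2 :* l :* n) := con 2 :* x :* l :* n) refl (2 ^ length S) L N ⟩
    2 ^ (1 + length S) * L * N                   ≡⟨ cong (λ e → 2 ^ e * L * N) (+-comm 1 (length S)) ⟩
    2 ^ (length S + 1) * L * N                   ∎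
    where
    open ≤-Reasoning
    S⊆D : S ⊆ D
    S⊆D q∈S = square-divisor∈D (All.lookup pS q∈S) (All.lookup S²∣N q∈S)
    S-bound : ∀ {q} → q ∈ S → q * (q * v q) ≤ 2 * b q
    S-bound q∈S = square-divisor-bound (All.lookup pS q∈S) (All.lookup S²∣N q∈S)

lemma2 : (k : ℕ) → k ≥ 1 → (p : Fin k → ℕ) → Injective _≡_ _≡_ p
    → (∀ i → Wieferich (p i))
    → let L = lcmFin k (λ i → p i ∸ 1) in
      prodFin k p * expμ (1 * (2 ^ L ∸ 1) * 2 ^ L) < 2 ^ L * (2 ^ (k + 1) * L)
lemma2 k _ p p-injective wieferich = begin-strict
  prodFin k p * expμ (1 * N * T)  ≡⟨ cong (λ x → prodFin k p * expμ (x * T)) (*-identityˡ N) ⟩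
  product S * expμ (N * T)
    ≤⟨ product*expμ[N*2^L]≤ N L (2∤2^n∸1 L) S uS (over-S (proj₁ ∘ wieferich)) (over-S p²∣N) ⟩
  2 ^ (length S + 1) * L * N      ≡⟨ cong (λ n → 2 ^ (n + 1) * L * N) |S|≡k ⟩
  2 ^ (k + 1) * L * N             <⟨ *-monoʳ-< (2 ^ (k + 1) * L) N<T ⟩
  2 ^ (k + 1) * L * T             ≡⟨ *-comm _ T ⟩
  T * (2 ^ (k + 1) * L)           ∎
  where
  open ≤-Reasoning
  S = map p (allFin k)
  over-S : ∀ {P : ℕ → Set} → (∀ i → P (p i)) → All P S
  over-S Pp = All.map⁺ (All.tabulate⁺ Pp)
  p∸1≢0 : ∀ i → NonZero (p i ∸ 1)
  p∸1≢0 i = ≢-nonZero (m>n⇒m∸n≢0 (prime⇒>1 (proj₁ (wieferich i))))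
  L = lcmFin k (λ i → p i ∸ 1)
  instance
    L≢0 : NonZero L
    L≢0 = foldr-lcm≢0 (All.map⁺ (All.tabulate⁺ p∸1≢0))
    2^[k+1]*L≢0 : NonZero (2 ^ (k + 1) * L)
    2^[k+1]*L≢0 = m*n≢0 _ L {{m^n≢0 2 (k + 1)}}
  T = 2 ^ L
  N = T ∸ 1
  N<T : N < T
  N<T = ∸-monoʳ-< z<s (m^n>0 2 L)
  uS : Unique S
  uS = Unique.map⁺ p-injective (allFin⁺ k)
  |S|≡k : length S ≡ k
  |S|≡k = trans (length-map p (allFin k)) (length-tabulate (λ i → i))
  p²∣N : ∀ i → p i ^ 2 ∣ N
  p²∣N i = ∣-trans (proj₂ (wieferich i))
                   (m^a∸1∣m^b∸1 2 (∈⇒∣foldr-lcm (∈-map⁺ (λ j → p j ∸ 1) (∈-allFin i))))
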